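{- Let $G$ be a finite simple graph, let $m,n$ be positive integers with $m<n$, and let $c$ be a nonnegative integer. If $\chi(G^{\frac{m}{n}})\leq\omega(G^{\frac{m}{n}})+c$, then $\chi(G^{\frac{m}{n+m+1}})\leq\omega(G^{\frac{m}{n+m+1}})+c$.
   Context: For a graph $G$ and positive integer $n$, the $n$-subdivision $G^{\frac{1}{n}}$ is obtained from $G$ by replacing each edge with a path of length $n$. For a graph $H$ and positive integer $m$, the $m$-th power $H^m$ is the graph on $V(H)$ in which two distinct vertices are adjacent iff their distance in $H$ is at most $m$. The fractional power is $G^{\frac{m}{n}}=(G^{\frac{1}{n}})^m$. $\chi$ denotes the chromatic number and $\omega$ the clique number. -}

module Defs where

open import Data.Nat using (ℕ; zero; suc; _∸_; _≤_; _<_; _<?_)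
open import Data.Fin using (Fin; fromℕ<) renaming (_<_ to _<ᶠ_)
open import Data.Bool using (Bool; true; false)
open import Data.Product using (Σ; _×_; _,_)
open import Data.Sum using (_⊎_; inj₁; inj₂)
open import Relation.Binary.PropositionalEquality using (_≡_; _≢_)
open import Relation.Nullary using (yes; no)

record SimpleGraph : Set where
  field
    N      : ℕ
    adj    : Fin N → Fin N → Bool
    sym    : ∀ u v → adj u v ≡ adj v u
    irrefl : ∀ v → adj v v ≡ false
open SimpleGraph public

record Graph : Set₁ where
  field
    V   : Set
    Adj : V → V → Set
open Graph public

Edge : SimpleGraph → Set
Edge G = Σ (Fin (N G)) λ u → Σ (Fin (N G)) λ v → (u <ᶠ v) × (adj G u v ≡ true)

-- Vertices of the n-subdivision: original vertices, plus n-1 internal vertices per edge.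
SubV : SimpleGraph → ℕ → Set
SubV G n = Fin (N G) ⊎ (Edge G × Fin (n ∸ 1))

-- pos e i : the i-th vertex (0 ≤ i ≤ n) on the path of length n replacing e = uv.
pos : (G : SimpleGraph) (n : ℕ) → Edge G → ℕ → SubV G n
pos G n (u , v , _ , _) zero = inj₁ u
pos G n e@(u , v , _ , _) (suc j) with j <? n ∸ 1
... | yes p = inj₂ (e , fromℕ< p)
... | no _  = inj₁ v

subdivision : SimpleGraph → ℕ → Graph
subdivision G n = record
  { V   = SubV G n
  ; Adj = λ x y → Σ (Edge G) λ e → Σ ℕ λ i → (i < n) ×
            (((pos G n e i ≡ x) × (pos G n e (suc i) ≡ y))
             ⊎ ((pos G n e (suc i) ≡ x) × (pos G n e i ≡ y)))
  }

data Walk (H : Graph) : V H → V H → ℕ → Set where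
  here : ∀ x → Walk H x x zero
  step : ∀ {x y z k} → Adj H x y → Walk H y z k → Walk H x z (suc k)

power : Graph → ℕ → Graph
power H m = record
  { V   = V H
  ; Adj = λ x y → (x ≢ y) × Σ ℕ λ k → (k ≤ m) × Walk H x y k
  }

fracPower : SimpleGraph → ℕ → ℕ → Graph
fracPower G m n = power (subdivision G n) m

Colouring : Graph → ℕ → Set
Colouring H k = Σ (V H → Fin k) λ f → ∀ x y → Adj H x y → f x ≢ f y

Clique : Graph → ℕ → Set
Clique H k = Σ (Fin k → V H) λ f → ∀ i j → i ≢ j → Adj H (f i) (f j)

IsChromaticNumber : Graph → ℕ → Set
IsChromaticNumber H k = Colouring H k × (∀ j → Colouring H j → k ≤ j)

IsCliqueNumber : Graph → ℕ → Set
IsCliqueNumber H k = Clique H k × (∀ j → Clique H j → j ≤ k)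

module Submission where

-- Write L for the subdivision parameter.  Every vertex of
-- G^{1/L} is a point of some edge e, at coordinate a ∈ [0, L] measured from
-- the smaller endpoint of e; equivalently it is the point at distance p from
-- the tail of a dart (an oriented edge).
--
--  * Walk normal form (`walk⇒Reach`): if x and y are joined by a walk of
--    length k < L then x = y, or they lie on one edge at coordinates at most
--    k apart, or they lie on two darts leaving a common branch vertex at
--    distances p, q with p + q ≤ k.  Conversely each shape gives a short walk.
--  * Colourings (`collapse-adj`): the map collapse : G^{1/(n+m+1)} → G^{1/n}
--    keeping coordinates a ≤ n and sending a > n to a − (m+1) preserves the
--    three shapes for k = m and keeps distinct vertices distinct, so it is a
--    homomorphism of m-th powers; hence χ(G^{m/(n+m+1)}) ≤ χ(G^{m/n}).
--  * Cliques (`CliqueShape`, `clique-lift`): for m < n every clique of G^{m/n}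
--    lies either in the interior of one edge or within distance m of one
--    branch vertex along its darts; both configurations have preimages under
--    collapse that are again cliques, so ω(G^{m/n}) ≤ ω(G^{m/(n+m+1)}).
--
-- The theorem follows: χ₂ ≤ χ₁ ≤ ω₁ + c ≤ ω₂ + c.

open import Defs
open import Data.Nat using (ℕ; zero; suc; _+_; _∸_; _≤_; _<_; _≤?_; _<?_; z≤n; s≤s; s≤s⁻¹)
open import Data.Nat.Properties
open import Data.Nat.Solver using (module +-*-Solver)
open import Data.Fin using (Fin; toℕ; fromℕ<) renaming (_≟_ to _≟ᶠ_)
import Data.Fin as Fin
open import Data.Fin.Properties using (toℕ-fromℕ<; fromℕ<-toℕ; toℕ<n; any?; all?; ¬∀⟶∃¬)
open import Data.Bool using (Bool; true; false; not) renaming (_≟_ to _≟ᵇ_)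
open import Data.Product using (Σ; _×_; _,_; proj₁; proj₂)
open import Data.Sum using (_⊎_; inj₁; inj₂)
open import Data.Empty using (⊥; ⊥-elim)
open import Relation.Binary.PropositionalEquality using (_≡_; _≢_; refl; trans; cong; cong₂; subst; subst₂) renaming (sym to sym≡)
open import Relation.Nullary using (¬_; yes; no; Dec)
open import Axiom.UniquenessOfIdentityProofs using (module Decidable⇒UIP)

Near : ℕ → ℕ → ℕ → Set
Near k a b = (a ≤ b + k) × (b ≤ a + k)

near-sym : ∀ {k a b} → Near k a b → Near k b a
near-sym (h₁ , h₂) = h₂ , h₁

near-0 : ∀ k b → Near k 0 b → b ≤ k
near-0 k b (_ , h) = h

near-mono : ∀ {j k a b} → j ≤ k → Near j a b → Near k a b
near-mono {a = a} {b} j≤k (h₁ , h₂) = ≤-trans h₁ (+-monoʳ-≤ b j≤k) , ≤-trans h₂ (+-monoʳ-≤ a j≤k)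

near-step : ∀ a b c k → Near 1 a b → Near k b c → Near (suc k) a c
near-step a b c k (h₁ , h₂) (g₁ , g₂) =
  (begin a ≤⟨ h₁ ⟩ b + 1 ≤⟨ +-monoˡ-≤ 1 g₁ ⟩ c + k + 1 ≡⟨ +-assoc c k 1 ⟩
         c + (k + 1) ≡⟨ cong (c +_) (+-comm k 1) ⟩ c + suc k ∎) ,
  (begin c ≤⟨ g₂ ⟩ b + k ≤⟨ +-monoˡ-≤ k h₂ ⟩ a + 1 + k ≡⟨ +-assoc a 1 k ⟩ a + suc k ∎)
  where open ≤-Reasoning

near-cancel : ∀ k c x y → Near k (c + x) (c + y) → Near k x y
near-cancel k c x y (h₁ , h₂) =
  +-cancelˡ-≤ c _ _ (subst (c + x ≤_) (+-assoc c y k) h₁) ,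
  +-cancelˡ-≤ c _ _ (subst (c + y ≤_) (+-assoc c x k) h₂)

module Subdivision (G : SimpleGraph) where

  Ed : Set
  Ed = Edge G

  src dst : Ed → Fin (N G)
  src e = proj₁ e
  dst e = proj₁ (proj₂ e)

  src<dst : (e : Ed) → toℕ (src e) < toℕ (dst e)
  src<dst (_ , _ , lt , _) = lt

  src≢dst : (e : Ed) → src e ≢ dst e
  src≢dst e eq = <-irrefl (cong toℕ eq) (src<dst e)

  edgeEq : (e f : Ed) → src e ≡ src f → dst e ≡ dst f → e ≡ f
  edgeEq (u , v , lt , a) (.u , .v , lt' , a') refl refl
    rewrite <-irrelevant lt lt' | Decidable⇒UIP.≡-irrelevant _≟ᵇ_ a a' = refl

  _≟E_ : (e f : Ed) → Dec (e ≡ f)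
  e ≟E f with src e ≟ᶠ src f | dst e ≟ᶠ dst f
  ... | yes p | yes q = yes (edgeEq e f p q)
  ... | no np | _     = no (λ eq → np (cong src eq))
  ... | yes _ | no nq = no (λ eq → nq (cong dst eq))

  Dart : Set
  Dart = Ed × Bool

  edge : Dart → Ed
  edge = proj₁

  tail head : Dart → Fin (N G)
  tail (e , false) = src e
  tail (e , true)  = dst e
  head (e , s) = tail (e , not s)

  head≢tail : (d : Dart) → head d ≢ tail d
  head≢tail (e , false) eq = src≢dst e (sym≡ eq)
  head≢tail (e , true)  eq = src≢dst e eq

  sameTail⇒sameSide : (e : Ed) (s₁ s₂ : Bool) → tail (e , s₁) ≡ tail (e , s₂) → s₁ ≡ s₂
  sameTail⇒sameSide e false false _ = refl
  sameTail⇒sameSide e true  true  _ = refl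
  sameTail⇒sameSide e false true  eq = ⊥-elim (src≢dst e eq)
  sameTail⇒sameSide e true  false eq = ⊥-elim (src≢dst e (sym≡ eq))

  dartByEnds : (d₁ d₂ : Dart) → tail d₁ ≡ tail d₂ → head d₁ ≡ head d₂ → d₁ ≡ d₂
  dartByEnds (e , false) (f , false) p q = cong (_, false) (edgeEq e f p q)
  dartByEnds (e , true)  (f , true)  p q = cong (_, true) (edgeEq e f q p)
  dartByEnds (e , false) (f , true)  p q =
    ⊥-elim (<-asym (subst₂ (λ a b → toℕ a < toℕ b) p q (src<dst e)) (src<dst f))
  dartByEnds (e , true)  (f , false) p q =
    ⊥-elim (<-asym (subst₂ (λ a b → toℕ a < toℕ b) q p (src<dst e)) (src<dst f))

  module Coordinates (L : ℕ) where

    S : Graph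
    S = subdivision G L

    P : Ed → ℕ → SubV G L
    P = pos G L

    pos-suc-cases : ∀ e j → (Σ (j < L ∸ 1) λ p → P e (suc j) ≡ inj₂ (e , fromℕ< p))
                          ⊎ ((¬ j < L ∸ 1) × P e (suc j) ≡ inj₁ (dst e))
    pos-suc-cases e j with j <? L ∸ 1
    ... | yes p = inj₁ (p , refl)
    ... | no np = inj₂ (np , refl)

    pos-end : ∀ e → 1 ≤ L → P e L ≡ inj₁ (dst e)
    pos-end e 1≤L with pos-suc-cases e (L ∸ 1)
    ... | inj₁ (p , _)  = ⊥-elim (<-irrefl refl p)
    ... | inj₂ (_ , eq) = subst (λ t → P e t ≡ inj₁ (dst e)) (m+[n∸m]≡n 1≤L) eq

    pos-inner : ∀ e a → 0 < a → a < L →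
                Σ (Fin (L ∸ 1)) λ j → (P e a ≡ inj₂ (e , j)) × (suc (toℕ j) ≡ a)
    pos-inner e (suc j) _ a<L with pos-suc-cases e j
    ... | inj₁ (p , eq) = fromℕ< p , eq , cong suc (toℕ-fromℕ< p)
    ... | inj₂ (np , _) = ⊥-elim (np (∸-monoˡ-≤ 1 a<L))

    pos≡inner : ∀ e a f j → a ≤ L → P e a ≡ inj₂ (f , j) → (e ≡ f) × (suc (toℕ j) ≡ a)
    pos≡inner e zero f j _ ()
    pos≡inner e (suc i) f j _ eq with pos-suc-cases e i
    ... | inj₁ (p , eq') with trans (sym≡ eq') eq
    ...   | refl = refl , cong suc (toℕ-fromℕ< p)
    pos≡inner e (suc i) f j _ eq | inj₂ (_ , eq') with trans (sym≡ eq') eq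
    ...   | ()

    pos≡branch : ∀ e a w → a ≤ L → P e a ≡ inj₁ w →
                 ((a ≡ 0) × (w ≡ src e)) ⊎ ((a ≡ L) × (w ≡ dst e))
    pos≡branch e zero w _ refl = inj₁ (refl , refl)
    pos≡branch e (suc i) w a≤L eq with pos-suc-cases e i
    ... | inj₁ (_ , eq') with trans (sym≡ eq') eq
    ...   | ()
    pos≡branch e (suc i) w a≤L eq | inj₂ (np , eq') with trans (sym≡ eq') eq
    ...   | refl = inj₂ (≤-antisym a≤L (≤-trans (m≤n+m∸n L 1) (s≤s (≮⇒≥ np))) , refl)

    pos-inner-injective : ∀ e f a b → 0 < a → a < L → b ≤ L → P e a ≡ P f b → (e ≡ f) × (a ≡ b)
    pos-inner-injective e f a b 0<a a<L b≤L eq with pos-inner e a 0<a a<L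
    ... | j , eqj , sj with pos≡inner f b e j b≤L (trans (sym≡ eq) eqj)
    ...   | f≡e , sb = sym≡ f≡e , trans (sym≡ sj) sb

    data CoordView (a : ℕ) : Set where
      atSrc : a ≡ 0 → CoordView a
      inner : 0 < a → a < L → CoordView a
      atDst : 0 < a → a ≡ L → CoordView a

    coordView : ∀ a → a ≤ L → CoordView a
    coordView zero    _   = atSrc refl
    coordView (suc a) a≤L with m≤n⇒m<n∨m≡n a≤L
    ... | inj₁ lt = inner (s≤s z≤n) lt
    ... | inj₂ eq = atDst (s≤s z≤n) eq

    pos-injective : ∀ e a b → a ≤ L → b ≤ L → P e a ≡ P e b → a ≡ b
    pos-injective e a b a≤L b≤L eq with coordView a a≤L
    ... | inner 0<a a<L = proj₂ (pos-inner-injective e e a b 0<a a<L b≤L eq)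
    ... | atSrc refl with pos≡branch e b (src e) b≤L (sym≡ eq)
    ...   | inj₁ (b≡0 , _) = sym≡ b≡0
    ...   | inj₂ (_ , w)   = ⊥-elim (src≢dst e w)
    pos-injective e a b a≤L b≤L eq | atDst 0<a refl
      with pos≡branch e b (dst e) b≤L (trans (sym≡ eq) (pos-end e 0<a))
    ...   | inj₁ (_ , w)    = ⊥-elim (src≢dst e (sym≡ w))
    ...   | inj₂ (b≡L , _)  = sym≡ b≡L

    coord : Bool → ℕ → ℕ
    coord false p = p
    coord true  p = L ∸ p

    along : Dart → ℕ → SubV G L
    along (e , s) p = P e (coord s p)

    along-0 : ∀ d → 1 ≤ L → along d 0 ≡ inj₁ (tail d)
    along-0 (e , false) _   = refl
    along-0 (e , true)  1≤L = pos-end e 1≤L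

    coord-involutive : ∀ s p → p ≤ L → coord s (coord s p) ≡ p
    coord-involutive false p _   = refl
    coord-involutive true  p p≤L = m∸[m∸n]≡n p≤L

    coord-injective : ∀ s p q → p ≤ L → q ≤ L → coord s p ≡ coord s q → p ≡ q
    coord-injective s p q p≤L q≤L eq =
      trans (sym≡ (coord-involutive s p p≤L)) (trans (cong (coord s) eq) (coord-involutive s q q≤L))

    coord≤ : ∀ s p → p ≤ L → coord s p ≤ L
    coord≤ false p p≤L = p≤L
    coord≤ true  p _   = m∸n≤m L p

    pos-as-along : ∀ e s a → a ≤ L → P e a ≡ along (e , s) (coord s a)
    pos-as-along e s a a≤L = cong (P e) (sym≡ (coord-involutive s a a≤L))

    coord-inner : ∀ s p → 0 < p → p < L → (0 < coord s p) × (coord s p < L)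
    coord-inner false p 0<p p<L = 0<p , p<L
    coord-inner true (suc p) _ p<L = m<n⇒0<n∸m p<L , ∸-monoʳ-< {L} {suc p} {0} (s≤s z≤n) (<⇒≤ p<L)

    along-inner : ∀ d p → 0 < p → p < L → Σ (Fin (L ∸ 1)) λ j → along d p ≡ inj₂ (edge d , j)
    along-inner (e , s) p 0<p p<L with coord-inner s p 0<p p<L
    ... | 0<c , c<L with pos-inner e (coord s p) 0<c c<L
    ...   | j , eq , _ = j , eq

    along-not-branch : ∀ d p w → 0 < p → p < L → along d p ≢ inj₁ w
    along-not-branch d p w 0<p p<L eq with along-inner d p 0<p p<L
    ... | j , eq' with trans (sym≡ eq') eq
    ...   | ()

    along≡pos : ∀ d p e a → 0 < p → p < L → a ≤ L → along d p ≡ P e a →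
                (edge d ≡ e) × (coord (proj₂ d) p ≡ a)
    along≡pos (e₁ , s₁) p e a 0<p p<L a≤L eq with coord-inner s₁ p 0<p p<L
    ... | 0<c , c<L = pos-inner-injective e₁ e (coord s₁ p) a 0<c c<L a≤L eq

    branch-as-tail : ∀ e a w → a ≤ L → P e a ≡ inj₁ w →
                     Σ Bool λ s → (coord s a ≡ 0) × (tail (e , s) ≡ w)
    branch-as-tail e a w a≤L eq with pos≡branch e a w a≤L eq
    ... | inj₁ (a≡0 , w≡) = false , a≡0 , sym≡ w≡
    ... | inj₂ (a≡L , w≡) = true , trans (cong (L ∸_) a≡L) (n∸n≡0 L) , sym≡ w≡

    tail-as-pos : ∀ e s a → a ≤ L → 1 ≤ L → coord s a ≡ 0 → P e a ≡ inj₁ (tail (e , s))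
    tail-as-pos e s a a≤L 1≤L c≡0 =
      trans (pos-as-along e s a a≤L) (trans (cong (along (e , s)) c≡0) (along-0 (e , s) 1≤L))

    coord-near : ∀ s a b k → a ≤ L → b ≤ L → Near k a b → Near k (coord s a) (coord s b)
    coord-near false a b k _ _ h = h
    coord-near true a b k a≤L b≤L (h₁ , h₂) = reflect a b a≤L b≤L h₂ , reflect b a b≤L a≤L h₁
      where
      reflect : ∀ a b → a ≤ L → b ≤ L → b ≤ a + k → L ∸ a ≤ (L ∸ b) + k
      reflect a b a≤L b≤L h = m≤n+o⇒m∸n≤o L a (begin
          L                 ≡⟨ sym≡ (m+[n∸m]≡n b≤L) ⟩
          b + (L ∸ b)       ≤⟨ +-monoˡ-≤ (L ∸ b) h ⟩
          a + k + (L ∸ b)   ≡⟨ +-assoc a k (L ∸ b) ⟩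
          a + (k + (L ∸ b)) ≡⟨ cong (a +_) (+-comm k (L ∸ b)) ⟩
          a + ((L ∸ b) + k) ∎)
        where open ≤-Reasoning

    adj-up : ∀ e i → i < L → Adj S (P e i) (P e (suc i))
    adj-up e i lt = e , i , lt , inj₁ (refl , refl)

    adj-down : ∀ e i → i < L → Adj S (P e (suc i)) (P e i)
    adj-down e i lt = e , i , lt , inj₂ (refl , refl)

    _++w_ : ∀ {x y z j k} → Walk S x y j → Walk S y z k → Walk S x z (j + k)
    here _   ++w w = w
    step a v ++w w = step a (v ++w w)

    walk-up : ∀ e a k → a + k ≤ L → Walk S (P e a) (P e (a + k)) k
    walk-up e a zero _ = subst (λ t → Walk S (P e a) (P e t) 0) (sym≡ (+-identityʳ a)) (here _)
    walk-up e a (suc k) h = step (adj-up e a (≤-trans (s≤s (m≤m+n a k)) h'))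
        (subst (λ t → Walk S (P e (suc a)) (P e t) k) (sym≡ (+-suc a k)) (walk-up e (suc a) k h'))
      where h' = subst (_≤ L) (+-suc a k) h

    walk-down : ∀ e a k → a + k ≤ L → Walk S (P e (a + k)) (P e a) k
    walk-down e a zero _ = subst (λ t → Walk S (P e t) (P e a) 0) (sym≡ (+-identityʳ a)) (here _)
    walk-down e a (suc k) h = subst (λ t → Walk S (P e t) (P e a) (suc k)) (sym≡ (+-suc a k))
        (step (adj-down e (a + k) h') (walk-down e a k (≤-trans (n≤1+n _) h')))
      where h' = subst (_≤ L) (+-suc a k) h

    ShortWalk : ℕ → SubV G L → SubV G L → Set
    ShortWalk k x y = Σ ℕ λ l → (l ≤ k) × Walk S x y l

    walk-on-edge : ∀ e a b k → a ≤ L → b ≤ L → Near k a b → ShortWalk k (P e a) (P e b)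
    walk-on-edge e a b k a≤L b≤L (h₁ , h₂) with ≤-total a b
    ... | inj₁ a≤b = b ∸ a , m≤n+o⇒m∸n≤o b a h₂ ,
          subst (λ t → Walk S (P e a) (P e t) (b ∸ a)) (m+[n∸m]≡n a≤b)
            (walk-up e a (b ∸ a) (subst (_≤ L) (sym≡ (m+[n∸m]≡n a≤b)) b≤L))
    ... | inj₂ b≤a = a ∸ b , m≤n+o⇒m∸n≤o a b h₁ ,
          subst (λ t → Walk S (P e t) (P e b) (a ∸ b)) (m+[n∸m]≡n b≤a)
            (walk-down e b (a ∸ b) (subst (_≤ L) (sym≡ (m+[n∸m]≡n b≤a)) a≤L))

    walk-to-tail : ∀ d p → 1 ≤ L → p ≤ L → Walk S (along d p) (inj₁ (tail d)) p
    walk-to-tail (e , false) p _ p≤L = walk-down e 0 p p≤L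
    walk-to-tail (e , true) p 1≤L p≤L =
      subst (λ t → Walk S (P e (L ∸ p)) t p) (trans (cong (P e) (m∸n+n≡m p≤L)) (pos-end e 1≤L))
        (walk-up e (L ∸ p) p (subst (_≤ L) (sym≡ (m∸n+n≡m p≤L)) ≤-refl))

    walk-from-tail : ∀ d p → 1 ≤ L → p ≤ L → Walk S (inj₁ (tail d)) (along d p) p
    walk-from-tail (e , false) p _ p≤L = walk-up e 0 p p≤L
    walk-from-tail (e , true) p 1≤L p≤L =
      subst (λ t → Walk S t (P e (L ∸ p)) p) (trans (cong (P e) (m∸n+n≡m p≤L)) (pos-end e 1≤L))
        (walk-down e (L ∸ p) p (subst (_≤ L) (sym≡ (m∸n+n≡m p≤L)) ≤-refl))

    walk-via-hub : ∀ d₁ d₂ p q → 1 ≤ L → p ≤ L → q ≤ L → tail d₁ ≡ tail d₂ →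
                   Walk S (along d₁ p) (along d₂ q) (p + q)
    walk-via-hub d₁ d₂ p q 1≤L p≤L q≤L t = walk-to-tail d₁ p 1≤L p≤L ++w
      subst (λ w → Walk S (inj₁ w) (along d₂ q) q) (sym≡ t) (walk-from-tail d₂ q 1≤L q≤L)

    data Reach (k : ℕ) (x y : SubV G L) : Set where
      same   : x ≡ y → Reach k x y
      onEdge : (e : Ed) (a b : ℕ) → a ≤ L → b ≤ L → Near k a b → x ≡ P e a → y ≡ P e b → Reach k x y
      viaHub : (d₁ d₂ : Dart) (p q : ℕ) → tail d₁ ≡ tail d₂ → p + q ≤ k →
               x ≡ along d₁ p → y ≡ along d₂ q → Reach k x y

    reach-mono : ∀ {j k x y} → j ≤ k → Reach j x y → Reach k x y
    reach-mono j≤k (same p) = same p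
    reach-mono j≤k (onEdge e a b a≤L b≤L h px py) = onEdge e a b a≤L b≤L (near-mono j≤k h) px py
    reach-mono j≤k (viaHub d₁ d₂ p q t s px py) = viaHub d₁ d₂ p q t (≤-trans s j≤k) px py

    module Prepend {k : ℕ} {x y : SubV G L} (e' : Ed) (a b : ℕ) (k<L : suc k < L)
                   (a≤L : a ≤ L) (b≤L : b ≤ L) (ab : Near 1 a b) (px : x ≡ P e' a) (py : y ≡ P e' b) where

      1≤L : 1 ≤ L
      1≤L = ≤-trans (s≤s z≤n) k<L

      leave-branch : ∀ w → y ≡ inj₁ w →
                     Σ Bool λ s → (tail (e' , s) ≡ w) × (coord s a ≤ 1) × (x ≡ along (e' , s) (coord s a))
      leave-branch w yw with branch-as-tail e' b w b≤L (trans (sym≡ py) yw)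
      ... | s , c≡0 , t = s , t ,
            near-0 1 _ (subst (λ c → Near 1 c (coord s a)) c≡0 (coord-near s b a 1 b≤L a≤L (near-sym ab))) ,
            trans px (pos-as-along e' s a a≤L)

      prepend : ∀ {z} → Reach k y z → Reach (suc k) x z
      prepend (same y≡z) = onEdge e' a b a≤L b≤L (near-mono (s≤s z≤n) ab) px (trans (sym≡ y≡z) py)
      prepend {z} (onEdge e c d c≤L d≤L cd py' pz) = byView (coordView c c≤L)
        where
        -- y = P e c is the branch vertex at side s of e: turn there.
        turn : (s : Bool) → coord s c ≡ 0 → Reach (suc k) x z
        turn s c≡0 with leave-branch (tail (e , s)) (trans py' (tail-as-pos e s c c≤L 1≤L c≡0))
        ... | s' , t , a' , px' =
          viaHub (e' , s') (e , s) (coord s' a) (coord s d) t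
            (+-mono-≤ a' (near-0 k _ (subst (λ u → Near k u (coord s d)) c≡0 (coord-near s c d k c≤L d≤L cd))))
            px' (trans pz (pos-as-along e s d d≤L))
        byView : CoordView c → Reach (suc k) x z
        byView (inner 0<c c<L) with pos-inner-injective e e' c b 0<c c<L b≤L (trans (sym≡ py') py)
        ... | refl , refl = onEdge e a d a≤L d≤L (near-step a c d k ab cd) px pz
        byView (atSrc c≡0)     = turn false c≡0
        byView (atDst _ c≡L)   = turn true (trans (cong (L ∸_) c≡L) (n∸n≡0 L))
      prepend (viaHub d₁ d₂ zero q t pq py' pz)
        with leave-branch (tail d₁) (trans py' (along-0 d₁ 1≤L))
      ... | s' , t' , a' , px' = viaHub (e' , s') d₂ (coord s' a) q (trans t' t) (+-mono-≤ a' pq) px' pz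
      prepend (viaHub (e₁ , s₁) d₂ (suc p) q t pq py' pz)
        with along≡pos (e₁ , s₁) (suc p) e' b (s≤s z≤n) p<L b≤L (trans (sym≡ py') py)
        where p<L = ≤-trans (s≤s (≤-trans (m≤m+n (suc p) q) pq)) (≤-trans (n≤1+n _) k<L)
      ... | refl , c≡b = viaHub (e₁ , s₁) d₂ (coord s₁ a) q t bound (trans px (pos-as-along e₁ s₁ a a≤L)) pz
        where
        open ≤-Reasoning
        c≤p+1 : coord s₁ a ≤ suc p + 1
        c≤p+1 = subst (λ u → coord s₁ a ≤ u + 1)
                  (trans (cong (coord s₁) (sym≡ c≡b))
                         (coord-involutive s₁ (suc p) (≤-trans (≤-trans (m≤m+n (suc p) q) pq) (<⇒≤ (≤-trans (n≤1+n _) k<L)))))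
                  (proj₁ (coord-near s₁ a b 1 a≤L b≤L ab))
        bound : coord s₁ a + q ≤ suc k
        bound = begin
          coord s₁ a + q  ≤⟨ +-monoˡ-≤ q c≤p+1 ⟩
          suc p + 1 + q   ≡⟨ cong (_+ q) (+-comm (suc p) 1) ⟩
          suc (suc p + q) ≤⟨ s≤s pq ⟩
          suc k           ∎

    walk⇒Reach : ∀ {x y k} → Walk S x y k → k < L → Reach k x y
    walk⇒Reach (here _) _ = same refl
    walk⇒Reach (step (e' , i , lt , inj₁ (px , py)) w) k<L =
      Prepend.prepend e' i (suc i) k<L (<⇒≤ lt) lt
        (≤-trans (n≤1+n i) (m≤m+n (suc i) 1) , ≤-reflexive (+-comm 1 i)) (sym≡ px) (sym≡ py)
        (walk⇒Reach w (≤-trans (n≤1+n _) k<L))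
    walk⇒Reach (step (e' , i , lt , inj₂ (px , py)) w) k<L =
      Prepend.prepend e' (suc i) i k<L lt (<⇒≤ lt)
        (≤-reflexive (+-comm 1 i) , ≤-trans (n≤1+n i) (m≤m+n (suc i) 1)) (sym≡ px) (sym≡ py)
        (walk⇒Reach w (≤-trans (n≤1+n _) k<L))

    along-inner-eq : ∀ d₁ d₂ p q → 0 < p → p < L → 0 < q → q < L → along d₁ p ≡ along d₂ q →
                     ((d₁ ≡ d₂) × (p ≡ q)) ⊎ ((edge d₁ ≡ edge d₂) × (tail d₂ ≡ head d₁) × (p + q ≡ L))
    along-inner-eq (e₁ , s₁) (e₂ , s₂) p q 0<p p<L 0<q q<L eq with coord-inner s₁ p 0<p p<L
    ... | 0<c , c<L with pos-inner-injective e₁ e₂ (coord s₁ p) (coord s₂ q) 0<c c<L (coord≤ s₂ q (<⇒≤ q<L)) eq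
    ...   | refl , c≡ = bySides s₁ s₂ c≡
      where
      bySides : ∀ s₁ s₂ → coord s₁ p ≡ coord s₂ q →
                (((e₁ , s₁) ≡ (e₁ , s₂)) × (p ≡ q)) ⊎ ((e₁ ≡ e₁) × (tail (e₁ , s₂) ≡ head (e₁ , s₁)) × (p + q ≡ L))
      bySides false false c = inj₁ (refl , c)
      bySides true  true  c = inj₁ (refl , coord-injective true p q (<⇒≤ p<L) (<⇒≤ q<L) c)
      bySides false true  c = inj₂ (refl , refl , trans (cong (_+ q) c) (m∸n+n≡m (<⇒≤ q<L)))
      bySides true  false c = inj₂ (refl , refl , trans (cong (p +_) (sym≡ c)) (m+[n∸m]≡n (<⇒≤ p<L)))

    hub-injective : ∀ d₁ d₂ p q → tail d₁ ≡ tail d₂ → p < L → q < L → along d₁ p ≡ along d₂ q →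
                    ((p ≡ 0) × (q ≡ 0)) ⊎ ((d₁ ≡ d₂) × (p ≡ q))
    hub-injective d₁ d₂ zero zero _ _ _ _ = inj₁ (refl , refl)
    hub-injective d₁ d₂ zero (suc q) _ p<L q<L eq =
      ⊥-elim (along-not-branch d₂ (suc q) (tail d₁) (s≤s z≤n) q<L (trans (sym≡ eq) (along-0 d₁ (≤-trans (s≤s z≤n) p<L))))
    hub-injective d₁ d₂ (suc p) zero _ p<L q<L eq =
      ⊥-elim (along-not-branch d₁ (suc p) (tail d₂) (s≤s z≤n) p<L (trans eq (along-0 d₂ (≤-trans (s≤s z≤n) q<L))))
    hub-injective d₁ d₂ (suc p) (suc q) t p<L q<L eq
      with along-inner-eq d₁ d₂ (suc p) (suc q) (s≤s z≤n) p<L (s≤s z≤n) q<L eq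
    ... | inj₁ r = inj₂ r
    ... | inj₂ (_ , o , _) = ⊥-elim (head≢tail d₁ (sym≡ (trans t o)))

    interior-edge : ∀ {e f : Ed} {j j' : Fin (L ∸ 1)} →
                    _≡_ {A = SubV G L} (inj₂ (e , j)) (inj₂ (f , j')) → e ≡ f
    interior-edge refl = refl

    module CliqueShape (m : ℕ) (m<L : m < L) where

      1≤L : 1 ≤ L
      1≤L = ≤-trans (s≤s z≤n) m<L

      below-L : ∀ {p} → p ≤ m → p < L
      below-L h = ≤-trans (s≤s h) m<L

      hub-pair : ∀ d₁ d₂ p q → tail d₁ ≡ tail d₂ → p ≤ m → q ≤ m → Reach m (along d₁ p) (along d₂ q) →
                 (p + q ≤ m) ⊎ ((d₁ ≡ d₂) × Near m p q)
      hub-pair d₁ d₂ zero q _ _ q≤m _ = inj₁ q≤m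
      hub-pair d₁ d₂ (suc p) zero _ p≤m _ _ = inj₁ (subst (_≤ m) (sym≡ (+-identityʳ _)) p≤m)
      hub-pair d₁ d₂ (suc p) (suc q) t p≤m q≤m (same eq)
        with hub-injective d₁ d₂ (suc p) (suc q) t (below-L p≤m) (below-L q≤m) eq
      ... | inj₁ (() , _)
      ... | inj₂ (d≡ , refl) = inj₂ (d≡ , m≤m+n _ m , m≤m+n _ m)
      hub-pair (e₁ , s₁) (e₂ , s₂) (suc p) (suc q) t p≤m q≤m (onEdge e a b a≤L b≤L ab px py)
        with along≡pos (e₁ , s₁) (suc p) e a (s≤s z≤n) (below-L p≤m) a≤L px
           | along≡pos (e₂ , s₂) (suc q) e b (s≤s z≤n) (below-L q≤m) b≤L py
      ... | refl , pa | refl , qb with sameTail⇒sameSide e₁ s₁ s₂ t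
      ...   | refl = inj₂ (refl , subst₂ (Near m)
                       (trans (cong (coord s₁) (sym≡ pa)) (coord-involutive s₁ _ (<⇒≤ (below-L p≤m))))
                       (trans (cong (coord s₁) (sym≡ qb)) (coord-involutive s₁ _ (<⇒≤ (below-L q≤m))))
                       (coord-near s₁ a b m a≤L b≤L ab))
      hub-pair d₁ d₂ (suc p) (suc q) t p≤m q≤m (viaHub d₃ d₄ zero q' t₃₄ s px py) =
        ⊥-elim (along-not-branch d₁ (suc p) (tail d₃) (s≤s z≤n) (below-L p≤m) (trans px (along-0 d₃ 1≤L)))
      hub-pair d₁ d₂ (suc p) (suc q) t p≤m q≤m (viaHub d₃ d₄ (suc p') zero t₃₄ s px py) =
        ⊥-elim (along-not-branch d₂ (suc q) (tail d₄) (s≤s z≤n) (below-L q≤m) (trans py (along-0 d₄ 1≤L)))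
      hub-pair d₁ d₂ (suc p) (suc q) t p≤m q≤m (viaHub d₃ d₄ (suc p') (suc q') t₃₄ s px py)
        with along-inner-eq d₁ d₃ (suc p) (suc p') (s≤s z≤n) (below-L p≤m) (s≤s z≤n) (below-L (m+n≤o⇒m≤o _ s)) px
           | along-inner-eq d₂ d₄ (suc q) (suc q') (s≤s z≤n) (below-L q≤m) (s≤s z≤n) (below-L (m+n≤o⇒n≤o (suc p') s)) py
      ... | inj₁ (refl , refl) | inj₁ (refl , refl) = inj₁ s
      ... | inj₁ (refl , refl) | inj₂ (_ , o₂ , _) = ⊥-elim (head≢tail d₂ (sym≡ (trans (trans (sym≡ t) t₃₄) o₂)))
      ... | inj₂ (_ , o₁ , _) | inj₁ (refl , refl) = ⊥-elim (head≢tail d₁ (sym≡ (trans (trans t (sym≡ t₃₄)) o₁)))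
      ... | inj₂ (_ , o₁ , e₁) | inj₂ (_ , o₂ , e₂) with dartByEnds d₁ d₂ t (trans (sym≡ o₁) (trans t₃₄ o₂))
      ...   | refl = inj₂ (refl , complement-near (suc p) (suc q) (suc p') (suc q') e₁ e₂ s ,
                               complement-near (suc q) (suc p) (suc q') (suc p') e₂ e₁ (subst (_≤ m) (+-comm (suc p') (suc q')) s))
        where
        -- Going around through the far end: p' + q' ≤ m with p + p' = q + q' = L forces |p − q| ≤ m.
        complement-near : ∀ a b a' b' → a + a' ≡ L → b + b' ≡ L → a' + b' ≤ m → a ≤ b + m
        complement-near a b a' b' ea eb s = begin
            a       ≤⟨ m≤m+n a a' ⟩
            a + a'  ≡⟨ trans ea (sym≡ eb) ⟩
            b + b'  ≤⟨ +-monoʳ-≤ b (m+n≤o⇒n≤o a' s) ⟩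
            b + m   ∎
          where open ≤-Reasoning

      reach-from-branch : ∀ w y → Reach m (inj₁ w) y → inj₁ w ≢ y →
                          Σ Dart λ d → Σ ℕ λ p → (tail d ≡ w) × (p ≤ m) × (y ≡ along d p)
      reach-from-branch w y (same eq) ne = ⊥-elim (ne eq)
      reach-from-branch w y (onEdge e a b a≤L b≤L ab px py) ne with branch-as-tail e a w a≤L (sym≡ px)
      ... | s , c≡0 , t = (e , s) , coord s b , t ,
            near-0 m _ (subst (λ u → Near m u (coord s b)) c≡0 (coord-near s a b m a≤L b≤L ab)) ,
            trans py (pos-as-along e s b b≤L)
      reach-from-branch w y (viaHub d₁ d₂ zero q t s px py) ne with trans px (along-0 d₁ 1≤L)
      ... | refl = d₂ , q , sym≡ t , s , py
      reach-from-branch w y (viaHub d₁ d₂ (suc p) q t s px py) ne =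
        ⊥-elim (along-not-branch d₁ (suc p) w (s≤s z≤n) (below-L (m+n≤o⇒m≤o _ s)) (sym≡ px))

      reach-same-edge : ∀ e a b → 0 < a → a < L → 0 < b → b < L → Reach m (P e a) (P e b) → Near m a b
      reach-same-edge e a b 0<a a<L 0<b b<L (same eq) with pos-injective e a b (<⇒≤ a<L) (<⇒≤ b<L) eq
      ... | refl = m≤m+n a m , m≤m+n a m
      reach-same-edge e a b 0<a a<L 0<b b<L (onEdge e' c d c≤L d≤L cd px py)
        with pos-inner-injective e e' a c 0<a a<L c≤L px | pos-inner-injective e e' b d 0<b b<L d≤L py
      ... | refl , refl | _ , refl = cd
      reach-same-edge e a b 0<a a<L 0<b b<L (viaHub d₁ d₂ zero q t s px py) with pos-inner e a 0<a a<L
      ... | j , eq , _ with trans (sym≡ eq) (trans px (along-0 d₁ 1≤L))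
      ...   | ()
      reach-same-edge e a b 0<a a<L 0<b b<L (viaHub d₁ d₂ (suc p) zero t s px py) with pos-inner e b 0<b b<L
      ... | j , eq , _ with trans (sym≡ eq) (trans py (along-0 d₂ 1≤L))
      ...   | ()
      reach-same-edge e a b 0<a a<L 0<b b<L (viaHub (e₁ , s₁) (e₂ , s₂) (suc p) (suc q) t s px py)
        with along≡pos (e₁ , s₁) (suc p) e a (s≤s z≤n) p<L (<⇒≤ a<L) (sym≡ px)
           | along≡pos (e₂ , s₂) (suc q) e b (s≤s z≤n) q<L (<⇒≤ b<L) (sym≡ py)
        where p<L = below-L (m+n≤o⇒m≤o _ s)
              q<L = below-L (m+n≤o⇒n≤o (suc p) s)
      ... | refl , pa | refl , qb with sameTail⇒sameSide e₁ s₁ s₂ t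
      ...   | refl = subst₂ (Near m) pa qb
                       (coord-near s₁ (suc p) (suc q) m (<⇒≤ (below-L (m+n≤o⇒m≤o _ s))) (<⇒≤ (below-L (m+n≤o⇒n≤o (suc p) s)))
                         (≤-trans (m≤m+n (suc p) (suc q)) (≤-trans s (m≤n+m m (suc q))) ,
                          ≤-trans (m≤n+m (suc q) (suc p)) (≤-trans s (m≤n+m m (suc p)))))

      reach-two-edges : ∀ x y e f j j' → x ≡ inj₂ (e , j) → y ≡ inj₂ (f , j') → e ≢ f → Reach m x y →
                        Σ Dart λ d₁ → Σ Dart λ d₂ → Σ ℕ λ p → Σ ℕ λ q →
                          (tail d₁ ≡ tail d₂) × (p + q ≤ m) × (x ≡ along d₁ p) × (y ≡ along d₂ q) ×
                          (edge d₁ ≡ e) × (edge d₂ ≡ f) × (0 < p) × (0 < q)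
      reach-two-edges x y e f j j' hx hy ne (same eq) = ⊥-elim (ne (interior-edge (trans (sym≡ hx) (trans eq hy))))
      reach-two-edges x y e f j j' hx hy ne (onEdge g a b a≤L b≤L _ px py)
        with pos≡inner g a e j a≤L (trans (sym≡ px) hx) | pos≡inner g b f j' b≤L (trans (sym≡ py) hy)
      ... | g≡e , _ | g≡f , _ = ⊥-elim (ne (trans (sym≡ g≡e) g≡f))
      reach-two-edges x y e f j j' hx hy ne (viaHub d₁ d₂ zero q t s px py) with trans (sym≡ hx) (trans px (along-0 d₁ 1≤L))
      ... | ()
      reach-two-edges x y e f j j' hx hy ne (viaHub d₁ d₂ (suc p) zero t s px py) with trans (sym≡ hy) (trans py (along-0 d₂ 1≤L))
      ... | ()
      reach-two-edges x y e f j j' hx hy ne (viaHub (e₁ , s₁) (e₂ , s₂) (suc p) (suc q) t s px py)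
        with pos≡inner e₁ (coord s₁ (suc p)) e j (coord≤ s₁ _ (<⇒≤ (below-L (m+n≤o⇒m≤o _ s)))) (trans (sym≡ px) hx)
           | pos≡inner e₂ (coord s₂ (suc q)) f j' (coord≤ s₂ _ (<⇒≤ (below-L (m+n≤o⇒n≤o (suc p) s)))) (trans (sym≡ py) hy)
      ... | ee , _ | ff , _ = (e₁ , s₁) , (e₂ , s₂) , suc p , suc q , t , s , px , py , ee , ff , s≤s z≤n , s≤s z≤n

      data Placement (z : SubV G L) (gz : Ed) (d₁ : Dart) (p : ℕ) : Set where
        nearTail : (d : Dart) (a : ℕ) → tail d ≡ tail d₁ → a ≤ m → z ≡ along d a → Placement z gz d₁ p
        nearHead : (d₃ : Dart) (a b : ℕ) → tail d₃ ≡ head d₁ → a + b ≤ m → p + b ≡ L → z ≡ along d₃ a →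
                   0 < a → edge d₃ ≡ gz → Placement z gz d₁ p
        sameEdge : gz ≡ edge d₁ → Placement z gz d₁ p

      placement : ∀ z gz jz d₁ p → z ≡ inj₂ (gz , jz) → 0 < p → p < L → z ≢ along d₁ p →
                  Reach m z (along d₁ p) → Placement z gz d₁ p
      placement z gz jz d₁ p hz 0<p p<L ne (same eq) = ⊥-elim (ne eq)
      placement z gz jz d₁ p hz 0<p p<L ne (onEdge g c c' c≤L c'≤L _ pz pk)
        with along≡pos d₁ p g c' 0<p p<L c'≤L pk | pos≡inner g c gz jz c≤L (trans (sym≡ pz) hz)
      ... | e₁≡g , _ | g≡gz , _ = sameEdge (trans (sym≡ g≡gz) (sym≡ e₁≡g))
      placement z gz jz d₁ p hz 0<p p<L ne (viaHub d₃ d₄ zero b t₃₄ s pz pk) with trans (sym≡ hz) (trans pz (along-0 d₃ 1≤L))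
      ... | ()
      placement z gz jz d₁ p hz 0<p p<L ne (viaHub d₃ d₄ (suc a) zero t₃₄ s pz pk) =
        ⊥-elim (along-not-branch d₁ p (tail d₄) 0<p p<L (trans pk (along-0 d₄ 1≤L)))
      placement z gz jz d₁ p hz 0<p p<L ne (viaHub d₃ d₄ (suc a) (suc b) t₃₄ s pz pk)
        with along-inner-eq d₁ d₄ p (suc b) 0<p p<L (s≤s z≤n) (below-L (m+n≤o⇒n≤o (suc a) s)) pk
      ... | inj₁ (refl , _) = nearTail d₃ (suc a) t₃₄ (m+n≤o⇒m≤o _ s) pz
      ... | inj₂ (_ , o , e) with along-inner d₃ (suc a) (s≤s z≤n) (below-L (m+n≤o⇒m≤o _ s))
      ...   | j₃ , eq₃ = nearHead d₃ (suc a) (suc b) (trans t₃₄ o) s e pz (s≤s z≤n)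
                           (interior-edge (trans (sym≡ eq₃) (trans (sym≡ pz) hz)))

      head-dart-same-edge : ∀ d₁ d₂ d₃ → edge d₃ ≡ edge d₂ → tail d₃ ≡ head d₁ → tail d₁ ≡ tail d₂ →
                            edge d₁ ≡ edge d₂
      head-dart-same-edge d₁ (e , s₂) (.e , s₃) refl t₃ t₁₂ = bySides s₂ s₃ t₃ t₁₂
        where
        bySides : ∀ s₂ s₃ → tail (e , s₃) ≡ head d₁ → tail d₁ ≡ tail (e , s₂) → edge d₁ ≡ e
        bySides false false t₃ t₁₂ = ⊥-elim (head≢tail d₁ (sym≡ (trans t₁₂ t₃)))
        bySides true  true  t₃ t₁₂ = ⊥-elim (head≢tail d₁ (sym≡ (trans t₁₂ t₃)))
        bySides false true  t₃ t₁₂ = cong edge (dartByEnds d₁ (e , false) t₁₂ (sym≡ t₃))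
        bySides true  false t₃ t₁₂ = cong edge (dartByEnds d₁ (e , true) t₁₂ (sym≡ t₃))

      -- Going all the way around an edge three times costs 3L > 3m.
      no-round-trip : ∀ a b a' b' p q → a + b ≤ m → a' + b' ≤ m → p + q ≤ m →
                      p + b ≡ L → q + b' ≡ L → a + a' ≡ L → ⊥
      no-round-trip a b a' b' p q h₁ h₂ h₃ e₁ e₂ e₃ = <-irrefl refl (begin-strict
          L + (L + L)                       ≡⟨ sym≡ (cong₂ _+_ e₁ (cong₂ _+_ e₂ e₃)) ⟩
          (p + b) + ((q + b') + (a + a'))   ≡⟨ solve 6 (λ a b a' b' p q → (p :+ b) :+ ((q :+ b') :+ (a :+ a'))
                                                  := (a :+ b) :+ ((a' :+ b') :+ (p :+ q))) refl a b a' b' p q ⟩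
          (a + b) + ((a' + b') + (p + q))   ≤⟨ +-mono-≤ h₁ (+-mono-≤ h₂ h₃) ⟩
          m + (m + m)                       <⟨ +-mono-<-≤ m<L (+-mono-≤ (<⇒≤ m<L) (<⇒≤ m<L)) ⟩
          L + (L + L)                       ∎)
        where open ≤-Reasoning
              open +-*-Solver

      near-common-hub : ∀ z gz d₁ d₂ p q → tail d₁ ≡ tail d₂ → p + q ≤ m → edge d₁ ≢ edge d₂ →
                        Placement z gz d₁ p → Placement z gz d₂ q →
                        Σ Dart λ d → Σ ℕ λ a → (tail d ≡ tail d₁) × (a ≤ m) × (z ≡ along d a)
      near-common-hub z gz d₁ d₂ p q t₁₂ pq ne (nearTail d a t a≤m pz) _ = d , a , t , a≤m , pz
      near-common-hub z gz d₁ d₂ p q t₁₂ pq ne (nearHead _ _ _ _ _ _ _ _ _) (nearTail d a t a≤m pz) =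
        d , a , trans t (sym≡ t₁₂) , a≤m , pz
      near-common-hub z gz d₁ d₂ p q t₁₂ pq ne (sameEdge _) (nearTail d a t a≤m pz) =
        d , a , trans t (sym≡ t₁₂) , a≤m , pz
      near-common-hub z gz d₁ d₂ p q t₁₂ pq ne (nearHead d₃ a b t₃ s pb pz 0<a _) (nearHead d₅ a' b' t₅ s' qb' pz' 0<a' _)
        with along-inner-eq d₃ d₅ a a' 0<a (below-L (m+n≤o⇒m≤o _ s)) 0<a' (below-L (m+n≤o⇒m≤o _ s')) (trans (sym≡ pz) pz')
      ... | inj₁ (refl , _) = ⊥-elim (ne (cong edge (dartByEnds d₁ d₂ t₁₂ (trans (sym≡ t₃) t₅))))
      ... | inj₂ (_ , _ , aa') = ⊥-elim (no-round-trip a b a' b' p q s s' pq pb qb' aa')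
      near-common-hub z gz d₁ d₂ p q t₁₂ pq ne (nearHead d₃ _ _ t₃ _ _ _ _ e₃) (sameEdge g₂) =
        ⊥-elim (ne (head-dart-same-edge d₁ d₂ d₃ (trans e₃ g₂) t₃ t₁₂))
      near-common-hub z gz d₁ d₂ p q t₁₂ pq ne (sameEdge g₁) (nearHead d₅ _ _ t₅ _ _ _ _ e₅) =
        ⊥-elim (ne (sym≡ (head-dart-same-edge d₂ d₁ d₅ (trans e₅ g₁) t₅ (sym≡ t₁₂))))
      near-common-hub z gz d₁ d₂ p q t₁₂ pq ne (sameEdge g₁) (sameEdge g₂) = ⊥-elim (ne (trans (sym≡ g₁) g₂))

  module Compare (m n : ℕ) (m<n : m < n) where

    Nb : ℕ
    Nb = n + m + 1

    module Sm = Coordinates n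
    module Bg = Coordinates Nb
    module SmShape = Sm.CliqueShape m m<n

    Nb≡ : Nb ≡ suc m + n
    Nb≡ = trans (+-assoc n m 1) (trans (cong (n +_) (+-comm m 1)) (+-comm n (suc m)))

    n≤Nb : n ≤ Nb
    n≤Nb = subst (n ≤_) (sym≡ Nb≡) (m≤n+m n (suc m))

    m<Nb : m < Nb
    m<Nb = ≤-trans m<n n≤Nb

    1≤n : 1 ≤ n
    1≤n = ≤-trans (s≤s z≤n) m<n

    1≤Nb : 1 ≤ Nb
    1≤Nb = ≤-trans 1≤n n≤Nb

    shrink : ℕ → ℕ
    shrink a with a ≤? n
    ... | yes _ = a
    ... | no _  = a ∸ suc m

    shrink-lo : ∀ a → a ≤ n → shrink a ≡ a
    shrink-lo a a≤n with a ≤? n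
    ... | yes _ = refl
    ... | no h  = ⊥-elim (h a≤n)

    shrink-hi : ∀ a → ¬ a ≤ n → suc m + shrink a ≡ a
    shrink-hi a h with a ≤? n
    ... | yes h' = ⊥-elim (h h')
    ... | no _   = m+[n∸m]≡n (≤-trans m<n (<⇒≤ (≰⇒> h)))

    shrink-Nb : shrink Nb ≡ n
    shrink-Nb = +-cancelˡ-≡ (suc m) _ _ (trans (shrink-hi Nb Nb≰n) Nb≡)
      where
      Nb≰n : ¬ Nb ≤ n
      Nb≰n h = <-irrefl refl (≤-trans (subst (n <_) (sym≡ Nb≡) (m<n+m n (s≤s z≤n))) h)

    shrink≤n : ∀ a → a ≤ Nb → shrink a ≤ n
    shrink≤n a a≤Nb = byCase (a ≤? n)
      where
      byCase : Dec (a ≤ n) → shrink a ≤ n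
      byCase (yes a≤n) = subst (_≤ n) (sym≡ (shrink-lo a a≤n)) a≤n
      byCase (no a≰n)  = +-cancelˡ-≤ (suc m) _ _ (subst₂ _≤_ (sym≡ (shrink-hi a a≰n)) Nb≡ a≤Nb)

    shrink-cross : ∀ a b → a ≤ n → ¬ b ≤ n → Near m a b → Near m a (shrink b) × (a ≢ shrink b)
    shrink-cross a b a≤n b≰n (_ , b≤a+m) = (a≤ , shrink≤) , a≢
      where
      open ≤-Reasoning
      b≡ : suc m + shrink b ≡ b
      b≡ = shrink-hi b b≰n
      a≤ : a ≤ shrink b + m
      a≤ = ≤-trans a≤n (s≤s⁻¹ (begin
             suc n              ≤⟨ ≰⇒> b≰n ⟩
             b                  ≡⟨ sym≡ b≡ ⟩
             suc m + shrink b   ≡⟨ cong suc (+-comm m (shrink b)) ⟩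
             suc (shrink b + m) ∎))
      shrink≤ : shrink b ≤ a + m
      shrink≤ = ≤-trans (m≤n+m (shrink b) (suc m)) (subst (_≤ a + m) (sym≡ b≡) b≤a+m)
      a≢ : a ≢ shrink b
      a≢ eq = <-irrefl refl (begin-strict
             b              ≤⟨ b≤a+m ⟩
             a + m          ≡⟨ cong (_+ m) eq ⟩
             shrink b + m   <⟨ ≤-reflexive (cong suc (+-comm (shrink b) m)) ⟩
             suc m + shrink b ≡⟨ b≡ ⟩
             b              ∎)

    shrink-near : ∀ a b → Near m a b → Near m (shrink a) (shrink b) × (shrink a ≡ shrink b → a ≡ b)
    shrink-near a b ab = byCase (a ≤? n) (b ≤? n)
      where
      byCase : Dec (a ≤ n) → Dec (b ≤ n) → Near m (shrink a) (shrink b) × (shrink a ≡ shrink b → a ≡ b)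
      byCase (yes a≤n) (yes b≤n) rewrite shrink-lo a a≤n | shrink-lo b b≤n = ab , λ eq → eq
      byCase (no a≰n) (no b≰n) =
        near-cancel m (suc m) _ _ (subst₂ (Near m) (sym≡ (shrink-hi a a≰n)) (sym≡ (shrink-hi b b≰n)) ab) ,
        λ eq → trans (sym≡ (shrink-hi a a≰n)) (trans (cong (suc m +_) eq) (shrink-hi b b≰n))
      byCase (yes a≤n) (no b≰n) rewrite shrink-lo a a≤n with shrink-cross a b a≤n b≰n ab
      ... | near , a≢ = near , λ eq → ⊥-elim (a≢ eq)
      byCase (no a≰n) (yes b≤n) rewrite shrink-lo b b≤n with shrink-cross b a b≤n a≰n (near-sym ab)
      ... | near , b≢ = near-sym near , λ eq → ⊥-elim (b≢ (sym≡ eq))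

    collapse : SubV G Nb → SubV G n
    collapse (inj₁ w)       = inj₁ w
    collapse (inj₂ (e , j)) = Sm.P e (shrink (suc (toℕ j)))

    collapse-pos : ∀ e a → a ≤ Nb → collapse (Bg.P e a) ≡ Sm.P e (shrink a)
    collapse-pos e zero _ = cong (Sm.P e) (sym≡ (shrink-lo 0 z≤n))
    collapse-pos e (suc j) a≤Nb with Bg.pos-suc-cases e j
    ... | inj₁ (p , eq) = trans (cong collapse eq) (cong (Sm.P e) (cong shrink (cong suc (toℕ-fromℕ< p))))
    ... | inj₂ (np , eq) = trans (cong collapse eq) (trans (sym≡ (Sm.pos-end e 1≤n))
            (cong (Sm.P e) (trans (sym≡ shrink-Nb) (cong shrink (sym≡ a≡Nb)))))
      where a≡Nb = ≤-antisym a≤Nb (≤-trans (m≤n+m∸n Nb 1) (s≤s (≮⇒≥ np)))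

    collapse-pos-lo : ∀ e a → a ≤ n → collapse (Bg.P e a) ≡ Sm.P e a
    collapse-pos-lo e a a≤n = trans (collapse-pos e a (≤-trans a≤n n≤Nb)) (cong (Sm.P e) (shrink-lo a a≤n))

    collapse-along : ∀ d p → p ≤ m → collapse (Bg.along d p) ≡ Sm.along d p
    collapse-along (e , false) p p≤m = collapse-pos-lo e p (≤-trans p≤m (<⇒≤ m<n))
    collapse-along (e , true) p p≤m = trans (collapse-pos e x (m∸n≤m Nb p)) (cong (Sm.P e) shrink-x)
      where
      open ≤-Reasoning
      x = Nb ∸ p
      x+p : x + p ≡ Nb
      x+p = m∸n+n≡m (≤-trans p≤m (<⇒≤ m<Nb))
      x≰n : ¬ x ≤ n
      x≰n x≤n = <-irrefl refl (begin-strict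
                 n + p     ≤⟨ +-monoʳ-≤ n p≤m ⟩
                 n + m     <⟨ m<m+n (n + m) (s≤s z≤n) ⟩
                 Nb        ≡⟨ sym≡ x+p ⟩
                 x + p     ≤⟨ +-monoˡ-≤ p x≤n ⟩
                 n + p     ∎)
      shrink-x : shrink x ≡ n ∸ p
      shrink-x = +-cancelˡ-≡ (suc m) _ _ (+-cancelʳ-≡ p _ _ (begin-equality
             suc m + shrink x + p  ≡⟨ cong (_+ p) (shrink-hi x x≰n) ⟩
             x + p                 ≡⟨ x+p ⟩
             Nb                    ≡⟨ Nb≡ ⟩
             suc m + n             ≡⟨ cong (suc m +_) (sym≡ (m∸n+n≡m (≤-trans p≤m (<⇒≤ m<n)))) ⟩
             suc m + (n ∸ p + p)   ≡⟨ sym≡ (+-assoc (suc m) (n ∸ p) p) ⟩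
             suc m + (n ∸ p) + p   ∎))

    SmallPow BigPow : Graph
    SmallPow = fracPower G m n
    BigPow   = fracPower G m Nb

    collapse-adj : ∀ x y → Adj BigPow x y → Adj SmallPow (collapse x) (collapse y)
    collapse-adj x y (x≢y , l , l≤m , w) = byShape (Bg.reach-mono l≤m (Bg.walk⇒Reach w (≤-trans (s≤s l≤m) m<Nb)))
      where
      byShape : Bg.Reach m x y → Adj SmallPow (collapse x) (collapse y)
      byShape (Bg.same eq) = ⊥-elim (x≢y eq)
      byShape (Bg.onEdge e a b a≤Nb b≤Nb ab px py) with shrink-near a b ab
      ... | near , shrink-inj with Sm.walk-on-edge e (shrink a) (shrink b) m (shrink≤n a a≤Nb) (shrink≤n b b≤Nb) near
      ...   | l' , l'≤m , w' = distinct , l' , l'≤m , subst₂ (λ u v → Walk Sm.S u v l') (sym≡ ex) (sym≡ ey) w'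
        where
        ex : collapse x ≡ Sm.P e (shrink a)
        ex = trans (cong collapse px) (collapse-pos e a a≤Nb)
        ey : collapse y ≡ Sm.P e (shrink b)
        ey = trans (cong collapse py) (collapse-pos e b b≤Nb)
        distinct : collapse x ≢ collapse y
        distinct eq with shrink-inj (Sm.pos-injective e (shrink a) (shrink b) (shrink≤n a a≤Nb) (shrink≤n b b≤Nb)
                                       (trans (sym≡ ex) (trans eq ey)))
        ... | refl = x≢y (trans px (sym≡ py))
      byShape (Bg.viaHub d₁ d₂ p q t s px py) = distinct , p + q , s ,
           subst₂ (λ u v → Walk Sm.S u v (p + q)) (sym≡ ex) (sym≡ ey)
             (Sm.walk-via-hub d₁ d₂ p q 1≤n (≤-trans p≤m (<⇒≤ m<n)) (≤-trans q≤m (<⇒≤ m<n)) t)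
        where
        p≤m : p ≤ m
        p≤m = m+n≤o⇒m≤o p s
        q≤m : q ≤ m
        q≤m = m+n≤o⇒n≤o p s
        ex : collapse x ≡ Sm.along d₁ p
        ex = trans (cong collapse px) (collapse-along d₁ p p≤m)
        ey : collapse y ≡ Sm.along d₂ q
        ey = trans (cong collapse py) (collapse-along d₂ q q≤m)
        distinct : collapse x ≢ collapse y
        distinct eq with Sm.hub-injective d₁ d₂ p q t (≤-trans (s≤s p≤m) m<n) (≤-trans (s≤s q≤m) m<n) (trans (sym≡ ex) (trans eq ey))
        ... | inj₁ (refl , refl) = x≢y (trans px (trans (Bg.along-0 d₁ 1≤Nb) (trans (cong inj₁ t) (trans (sym≡ (Bg.along-0 d₂ 1≤Nb)) (sym≡ py)))))
        ... | inj₂ (refl , refl) = x≢y (trans px (sym≡ py))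

    colouring-pullback : ∀ k → Colouring SmallPow k → Colouring BigPow k
    colouring-pullback k (f , proper) = (λ x → f (collapse x)) , λ x y a → proper (collapse x) (collapse y) (collapse-adj x y a)

    lift-clique : ∀ k (K : Fin k → SubV G n) → (∀ i j → i ≢ j → K i ≢ K j) → (K' : Fin k → SubV G Nb) →
                  (∀ i → collapse (K' i) ≡ K i) → (∀ i j → i ≢ j → Bg.ShortWalk m (K' i) (K' j)) →
                  Clique BigPow k
    lift-clique k K distinct K' lifts walks = K' , λ i j i≢j →
      (λ eq → distinct i j i≢j (trans (sym≡ (lifts i)) (trans (cong collapse eq) (lifts j)))) , walks i j i≢j

    NearHub : SubV G n → Fin (N G) → Set
    NearHub x w = (x ≡ inj₁ w) ⊎ (Σ Dart λ d → Σ ℕ λ p → (tail d ≡ w) × (p ≤ m) × (x ≡ Sm.along d p))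

    lift-hub : ∀ {x w} → NearHub x w → SubV G Nb
    lift-hub {w = w} (inj₁ _)          = inj₁ w
    lift-hub (inj₂ (d , p , _)) = Bg.along d p

    lift-hub-collapse : ∀ {x w} (h : NearHub x w) → collapse (lift-hub h) ≡ x
    lift-hub-collapse (inj₁ eq)                     = sym≡ eq
    lift-hub-collapse (inj₂ (d , p , _ , p≤m , eq)) = trans (collapse-along d p p≤m) (sym≡ eq)

    m-close : ∀ {p} → p ≤ m → p ≤ Nb
    m-close h = ≤-trans h (<⇒≤ m<Nb)

    lift-hub-walk : ∀ {x y w} (hx : NearHub x w) (hy : NearHub y w) → x ≢ y → Sm.Reach m x y →
                    Bg.ShortWalk m (lift-hub hx) (lift-hub hy)
    lift-hub-walk (inj₁ a) (inj₁ b) x≢y _ = ⊥-elim (x≢y (trans a (sym≡ b)))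
    lift-hub-walk (inj₁ _) (inj₂ (d , q , t , q≤m , _)) _ _ =
      q , q≤m , subst (λ u → Walk Bg.S (inj₁ u) (Bg.along d q) q) t (Bg.walk-from-tail d q 1≤Nb (m-close q≤m))
    lift-hub-walk (inj₂ (d , p , t , p≤m , _)) (inj₁ _) _ _ =
      p , p≤m , subst (λ u → Walk Bg.S (Bg.along d p) (inj₁ u) p) t (Bg.walk-to-tail d p 1≤Nb (m-close p≤m))
    lift-hub-walk (inj₂ ((e , s) , p , t₁ , p≤m , ex)) (inj₂ (d₂ , q , t₂ , q≤m , ey)) _ r
      with SmShape.hub-pair (e , s) d₂ p q (trans t₁ (sym≡ t₂)) p≤m q≤m (subst₂ (Sm.Reach m) ex ey r)
    ... | inj₁ p+q≤m = p + q , p+q≤m , Bg.walk-via-hub (e , s) d₂ p q 1≤Nb (m-close p≤m) (m-close q≤m) (trans t₁ (sym≡ t₂))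
    ... | inj₂ (refl , pq) = Bg.walk-on-edge e (Bg.coord s p) (Bg.coord s q) m
                               (Bg.coord≤ s p (m-close p≤m)) (Bg.coord≤ s q (m-close q≤m))
                               (Bg.coord-near s p q m (m-close p≤m) (m-close q≤m) pq)

    hub-clique : ∀ k (K : Fin k → SubV G n) → (∀ i j → i ≢ j → K i ≢ K j) → (∀ i j → i ≢ j → Sm.Reach m (K i) (K j)) →
                 (w : Fin (N G)) → (∀ i → NearHub (K i) w) → Clique BigPow k
    hub-clique k K distinct close w near = lift-clique k K distinct (λ i → lift-hub (near i))
      (λ i → lift-hub-collapse (near i)) (λ i j i≢j → lift-hub-walk (near i) (near j) (distinct i j i≢j) (close i j i≢j))

    edge-clique : ∀ k (K : Fin k → SubV G n) → (∀ i j → i ≢ j → K i ≢ K j) → (∀ i j → i ≢ j → Sm.Reach m (K i) (K j)) →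
                  (e : Ed) (t : Fin k → ℕ) → (∀ i → 0 < t i) → (∀ i → t i < n) → (∀ i → K i ≡ Sm.P e (t i)) →
                  Clique BigPow k
    edge-clique k K distinct close e t 0<t t<n onE = lift-clique k K distinct (λ i → Bg.P e (t i))
      (λ i → trans (collapse-pos-lo e (t i) (<⇒≤ (t<n i))) (sym≡ (onE i)))
      (λ i j i≢j → Bg.walk-on-edge e (t i) (t j) m (≤-trans (<⇒≤ (t<n i)) n≤Nb) (≤-trans (<⇒≤ (t<n j)) n≤Nb)
         (SmShape.reach-same-edge e (t i) (t j) (0<t i) (t<n i) (0<t j) (t<n j)
           (subst₂ (Sm.Reach m) (onE i) (onE j) (close i j i≢j))))

    IsBranch : SubV G n → Set
    IsBranch x = Σ (Fin (N G)) λ w → x ≡ inj₁ w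

    isBranch? : (x : SubV G n) → Dec (IsBranch x)
    isBranch? (inj₁ w) = yes (w , refl)
    isBranch? (inj₂ _) = no λ { (_ , ()) }

    interior-of : ∀ x → ¬ IsBranch x → Σ Ed λ e → Σ (Fin (n ∸ 1)) λ j → x ≡ inj₂ (e , j)
    interior-of (inj₁ w)       nb = ⊥-elim (nb (w , refl))
    interior-of (inj₂ (e , j)) _  = e , j , refl

    pos-interior : ∀ e (j : Fin (n ∸ 1)) → Sm.P e (suc (toℕ j)) ≡ inj₂ (e , j)
    pos-interior e j with Sm.pos-suc-cases e (toℕ j)
    ... | inj₁ (p , eq) = trans eq (cong (λ u → inj₂ (e , u)) (fromℕ<-toℕ j p))
    ... | inj₂ (np , _) = ⊥-elim (np (toℕ<n j))

    interior<n : ∀ (j : Fin (n ∸ 1)) → suc (toℕ j) < n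
    interior<n j = subst (suc (suc (toℕ j)) ≤_) (m+[n∸m]≡n 1≤n) (s≤s (toℕ<n j))

    module LiftClique (k : ℕ) (K : Fin (suc k) → SubV G n) (clique : ∀ i j → i ≢ j → Adj SmallPow (K i) (K j)) where

      distinct : ∀ i j → i ≢ j → K i ≢ K j
      distinct i j i≢j = proj₁ (clique i j i≢j)

      close : ∀ i j → i ≢ j → Sm.Reach m (K i) (K j)
      close i j i≢j with clique i j i≢j
      ... | _ , l , l≤m , w = Sm.reach-mono l≤m (Sm.walk⇒Reach w (≤-trans (s≤s l≤m) m<n))

      -- Some member is a branch vertex w: everything else is near w.
      with-branch : (i₀ : Fin (suc k)) (w : Fin (N G)) → K i₀ ≡ inj₁ w → Clique BigPow (suc k)
      with-branch i₀ w K≡w = hub-clique (suc k) K distinct close w near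
        where
        near : ∀ j → NearHub (K j) w
        near j with j ≟ᶠ i₀
        ... | yes refl = inj₁ K≡w
        ... | no j≢i₀ = inj₂ (SmShape.reach-from-branch w (K j)
                          (subst (λ u → Sm.Reach m u (K j)) K≡w (close i₀ j (λ eq → j≢i₀ (sym≡ eq))))
                          (λ eq → distinct i₀ j (λ eq' → j≢i₀ (sym≡ eq')) (trans K≡w eq)))

      module AllInterior (noBranch : ¬ (Σ (Fin (suc k)) λ i → IsBranch (K i))) where

        E : Fin (suc k) → Ed
        E i = proj₁ (interior-of (K i) (λ b → noBranch (i , b)))

        J : Fin (suc k) → Fin (n ∸ 1)
        J i = proj₁ (proj₂ (interior-of (K i) (λ b → noBranch (i , b))))

        K≡ : ∀ i → K i ≡ inj₂ (E i , J i)
        K≡ i = proj₂ (proj₂ (interior-of (K i) (λ b → noBranch (i , b))))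

        one-edge : (∀ i → E i ≡ E Fin.zero) → Clique BigPow (suc k)
        one-edge sameE = edge-clique (suc k) K distinct close (E Fin.zero) (λ i → suc (toℕ (J i)))
          (λ _ → s≤s z≤n) (λ i → interior<n (J i))
          (λ i → trans (K≡ i) (trans (cong (λ e → inj₂ (e , J i)) (sameE i)) (sym≡ (pos-interior (E Fin.zero) (J i)))))

        -- Members 0 and i₁ on different edges meet at a hub; every other member is near it.
        two-edges : (i₁ : Fin (suc k)) → E i₁ ≢ E Fin.zero → Clique BigPow (suc k)
        two-edges i₁ E≢ with SmShape.reach-two-edges (K Fin.zero) (K i₁) (E Fin.zero) (E i₁) (J Fin.zero) (J i₁)
                               (K≡ Fin.zero) (K≡ i₁) (λ eq → E≢ (sym≡ eq)) (close Fin.zero i₁ (λ eq → E≢ (cong E (sym≡ eq))))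
        ... | d₁ , d₂ , p , q , t , p+q≤m , K₀≡ , K₁≡ , ed₁ , ed₂ , 0<p , 0<q = hub-clique (suc k) K distinct close (tail d₁) near
          where
          p≤m : p ≤ m
          p≤m = m+n≤o⇒m≤o p p+q≤m
          q≤m : q ≤ m
          q≤m = m+n≤o⇒n≤o p p+q≤m
          edges≢ : edge d₁ ≢ edge d₂
          edges≢ eq = E≢ (trans (sym≡ ed₂) (trans (sym≡ eq) ed₁))
          placed : ∀ j → (d : Dart) (r : ℕ) (i : Fin (suc k)) → j ≢ i → K i ≡ Sm.along d r → 0 < r → r ≤ m →
                   SmShape.Placement (K j) (E j) d r
          placed j d r i j≢i Ki≡ 0<r r≤m =
            SmShape.placement (K j) (E j) (J j) d r (K≡ j) 0<r (≤-trans (s≤s r≤m) m<n)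
              (λ eq → distinct j i j≢i (trans eq (sym≡ Ki≡))) (subst (Sm.Reach m (K j)) Ki≡ (close j i j≢i))
          near : ∀ j → NearHub (K j) (tail d₁)
          near j with j ≟ᶠ Fin.zero | j ≟ᶠ i₁
          ... | yes refl | _ = inj₂ (d₁ , p , refl , p≤m , K₀≡)
          ... | no _ | yes refl = inj₂ (d₂ , q , sym≡ t , q≤m , K₁≡)
          ... | no j≢0 | no j≢i₁ = inj₂ (SmShape.near-common-hub (K j) (E j) d₁ d₂ p q t p+q≤m edges≢
                                     (placed j d₁ p Fin.zero j≢0 K₀≡ 0<p p≤m) (placed j d₂ q i₁ j≢i₁ K₁≡ 0<q q≤m))

        lifted : Clique BigPow (suc k)
        lifted with all? (λ i → E i ≟E E Fin.zero)
        ... | yes sameE = one-edge sameE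
        ... | no notAll with ¬∀⟶∃¬ (suc k) (λ i → E i ≡ E Fin.zero) (λ i → E i ≟E E Fin.zero) notAll
        ...   | i₁ , E≢ = two-edges i₁ E≢

      lifted : Clique BigPow (suc k)
      lifted with any? (λ i → isBranch? (K i))
      ... | yes (i₀ , w , K≡w) = with-branch i₀ w K≡w
      ... | no noBranch        = AllInterior.lifted noBranch

    clique-lift : ∀ k → Clique SmallPow k → Clique BigPow k
    clique-lift zero    _            = (λ ()) , (λ ())
    clique-lift (suc k) (K , clique) = LiftClique.lifted k K clique

lemma2p2 : (G : SimpleGraph) (m n c : ℕ) → 1 ≤ m → m < n →
    (χ₁ ω₁ : ℕ) → IsChromaticNumber (fracPower G m n) χ₁ → IsCliqueNumber (fracPower G m n) ω₁ →
    χ₁ ≤ ω₁ + c →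
    (χ₂ ω₂ : ℕ) → IsChromaticNumber (fracPower G m (n + m + 1)) χ₂ →
    IsCliqueNumber (fracPower G m (n + m + 1)) ω₂ →
    χ₂ ≤ ω₂ + c
lemma2p2 G m n c _ m<n χ₁ ω₁ (colouring₁ , _) (clique₁ , _) χ₁≤ω₁+c χ₂ ω₂ (_ , χ₂-minimal) (_ , ω₂-maximal) =
  begin
    χ₂      ≤⟨ χ₂-minimal χ₁ (colouring-pullback χ₁ colouring₁) ⟩
    χ₁      ≤⟨ χ₁≤ω₁+c ⟩
    ω₁ + c  ≤⟨ +-monoˡ-≤ c (ω₂-maximal ω₁ (clique-lift ω₁ clique₁)) ⟩
    ω₂ + c  ∎
  where
  open ≤-Reasoning
  open Subdivision.Compare G m n m<n
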